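{- Let $R$ be an integral domain with unit, $p,q\in R$, $U=(U_n)$ with $U_0=0$, $U_1=1$, $U_n=pU_{n-1}-qU_{n-2}$, $T=(T_n)$ with $T_0=1$, $T_1=0$, $T_n=pT_{n-1}-qT_{n-2}$, and $x_n=U_n/U_{n-1}$ for $n\ge2$. Let $F$ be the Fibonacci sequence ($F_0=0$, $F_1=1$, $F_n=F_{n-1}+F_{n-2}$). Then for all $n\ge5$, $$U_{F_n}=U_{F_{n-1}}T_{F_{n-2}}+T_{F_{n-1}}U_{F_{n-2}}+pU_{F_{n-1}}U_{F_{n-2}}=-q\left(U_{F_{n-1}}U_{F_{n-2}-1}+U_{F_{n-1}-1}U_{F_{n-2}}\right)+pU_{F_{n-1}}U_{F_{n-2}},$$ and (whenever the quotients are defined in the field of fractions of $R$) $$x_{F_n}=\frac{qx_{F_{n-1}}+qx_{F_{n-2}}-px_{F_{n-1}}x_{F_{n-2}}}{q-x_{F_{n-1}}x_{F_{n-2}}}.$$ -}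

module Defs where

open import Level using (_⊔_) renaming (suc to lsuc)
open import Algebra.Bundles using (CommutativeRing)
open import Data.Nat using (ℕ; zero; suc)
open import Data.Product using (_×_; _,_)
open import Data.Sum using (_⊎_)
open import Relation.Nullary using (¬_)

record IntegralDomain c ℓ : Set (lsuc (c ⊔ ℓ)) where
  field
    commutativeRing : CommutativeRing c ℓ
  open CommutativeRing commutativeRing public
  field
    1≉0            : ¬ (1# ≈ 0#)
    noZeroDivisors : ∀ a b → a * b ≈ 0# → a ≈ 0# ⊎ b ≈ 0#

F : ℕ → ℕ
F zero = 0
F (suc zero) = 1
F (suc (suc n)) = F (suc n) Data.Nat.+ F n

module Lucas {c ℓ} (D : IntegralDomain c ℓ) (p q : IntegralDomain.Carrier D) where
  open IntegralDomain D hiding (zero)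

  U : ℕ → Carrier
  U zero = 0#
  U (suc zero) = 1#
  U (suc (suc n)) = p * U (suc n) - q * U n

  T : ℕ → Carrier
  T zero = 1#
  T (suc zero) = 0#
  T (suc (suc n)) = p * T (suc n) - q * T n

  -- Field of fractions of R: a fraction is a pair (numerator , denominator);
  -- it is a genuine element of Frac(R) when its denominator is nonzero.
  -- Equality is the usual cross-multiplication.
  Frac : Set c
  Frac = Carrier × Carrier

  num : Frac → Carrier
  num (a , b) = a

  den : Frac → Carrier
  den (a , b) = b

  Defined : Frac → Set ℓ
  Defined f = ¬ (den f ≈ 0#)

  NonZeroF : Frac → Set ℓ
  NonZeroF f = ¬ (num f ≈ 0#)

  infix 4 _≈F_
  _≈F_ : Frac → Frac → Set ℓ
  (a , b) ≈F (c , d) = a * d ≈ c * b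

  ι : Carrier → Frac
  ι a = (a , 1#)

  infixl 6 _+F_ _-F_
  infixl 7 _*F_ _/F_
  _+F_ : Frac → Frac → Frac
  (a , b) +F (c , d) = (a * d + c * b , b * d)

  _-F_ : Frac → Frac → Frac
  (a , b) -F (c , d) = (a * d - c * b , b * d)

  _*F_ : Frac → Frac → Frac
  (a , b) *F (c , d) = (a * c , b * d)

  -- division; meaningful when the divisor is a nonzero element (NonZeroF)
  _/F_ : Frac → Frac → Frac
  (a , b) /F (c , d) = (a * d , b * c)

  -- x n = U n / U (n-1)  (used for n ≥ 2; defined when U (n-1) ≠ 0)
  x : ℕ → Frac
  x zero = (U zero , 0#)
  x (suc n) = (U (suc n) , U n)

module Submission where

-- For U, T with the recurrence  W (n+2) = p W (n+1) - q W n  and the initial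
-- values of Defs.Lucas, the whole corollary rests on two identities valid in
-- any commutative ring:
--   * the addition law  U (m + k + 1) = U (m+1) U (k+1) - q U m U k, and
--   * T (b + 1) = - q U b.
-- Substituting them, each of the three claims for a pair a , b ≥ 1 becomes a
-- polynomial identity in p, q, U a, U (a-1), U b, U (b-1).  The corollary is the instance a = F (n-1), b = F (n-2), since
-- F n = F (n-1) + F (n-2) by definition and both indices are positive.

open import Defs
open import Algebra.Bundles using (CommutativeRing)
open import Data.Nat using (ℕ; zero; suc; _≤_; _∸_; z≤n; s≤s) renaming (_+_ to _+ℕ_; _*_ to _*ℕ_)
open import Data.Nat.Properties using (≤-trans; m≤m+n; +-suc)
open import Data.Integer using (ℤ; +_; -[1+_]; _⊖_; _◃_; +-*-rawRing)
  renaming (_+_ to _+ℤ_; _*_ to _*ℤ_; -_ to -ℤ_)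
import Data.Integer.Properties as ℤ
open import Data.Sign using (Sign)
open import Data.Maybe using (Maybe; map)
open import Data.Product using (_×_; _,_; proj₁; proj₂)
import Relation.Binary.PropositionalEquality as ≡
open import Relation.Binary.Consequences using (dec⇒weaklyDec)
import Algebra.Solver.Ring.AlmostCommutativeRing as ACR

-- Integer coefficients let the solver normalise away cancellations such as
-- (-1)·(-1) = 1, which it cannot detect with coefficients taken from R itself.
module IntegerCoefficientSolver {c ℓ} (R : CommutativeRing c ℓ) where
  open CommutativeRing R
  open import Algebra.Properties.Ring ring using (-0#≈0#; -‿distribˡ-*; -‿distribʳ-*)
  open import Algebra.Properties.AbelianGroup +-abelianGroup using (⁻¹-∙-comm)
  open import Algebra.Properties.Group +-group using (⁻¹-involutive)
  open import Algebra.Properties.CommutativeSemigroup +-commutativeSemigroup using (interchange)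
  open import Algebra.Properties.Semiring.Mult.TCOptimised semiring
    using (1+×; ×-homo-+; ×1-homo-*) renaming (_×_ to _·_)
  open import Relation.Binary.Reasoning.Setoid setoid

  ⟦_⟧ℕ : ℕ → Carrier
  ⟦ n ⟧ℕ = n · 1#

  ⟦_⟧ℤ : ℤ → Carrier
  ⟦ + n ⟧ℤ = ⟦ n ⟧ℕ
  ⟦ -[1+ n ] ⟧ℤ = - ⟦ suc n ⟧ℕ

  -‿homo : ∀ i → ⟦ -ℤ i ⟧ℤ ≈ - ⟦ i ⟧ℤ
  -‿homo (+ zero) = sym -0#≈0#
  -‿homo (+ suc n) = refl
  -‿homo -[1+ n ] = sym (⁻¹-involutive _)

  cancel-1+ : ∀ x y → (1# + x) - (1# + y) ≈ x - y
  cancel-1+ x y = begin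
    (1# + x) - (1# + y)     ≈⟨ +-cong refl (⁻¹-∙-comm 1# y) ⟨
    (1# + x) + (- 1# - y)   ≈⟨ interchange 1# x (- 1#) (- y) ⟩
    (1# - 1#) + (x - y)     ≈⟨ +-cong (-‿inverseʳ 1#) refl ⟩
    0# + (x - y)            ≈⟨ +-identityˡ _ ⟩
    x - y                   ∎

  ⊖-homo : ∀ m n → ⟦ m ⊖ n ⟧ℤ ≈ ⟦ m ⟧ℕ - ⟦ n ⟧ℕ
  ⊖-homo zero zero = sym (-‿inverseʳ 0#)
  ⊖-homo (suc m) zero = sym (trans (+-cong refl -0#≈0#) (+-identityʳ _))
  ⊖-homo zero (suc n) = sym (+-identityˡ _)
  ⊖-homo (suc m) (suc n) rewrite ℤ.[1+m]⊖[1+n]≡m⊖n m n = begin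
    ⟦ m ⊖ n ⟧ℤ                           ≈⟨ ⊖-homo m n ⟩
    ⟦ m ⟧ℕ - ⟦ n ⟧ℕ                      ≈⟨ cancel-1+ ⟦ m ⟧ℕ ⟦ n ⟧ℕ ⟨
    (1# + ⟦ m ⟧ℕ) - (1# + ⟦ n ⟧ℕ)        ≈⟨ +-cong (1+× m 1#) (-‿cong (1+× n 1#)) ⟨
    ⟦ suc m ⟧ℕ - ⟦ suc n ⟧ℕ              ∎

  +‿homo : ∀ i j → ⟦ i +ℤ j ⟧ℤ ≈ ⟦ i ⟧ℤ + ⟦ j ⟧ℤ
  +‿homo (+ m) (+ n) = ×-homo-+ 1# m n
  +‿homo (+ m) -[1+ n ] = ⊖-homo m (suc n)
  +‿homo -[1+ m ] (+ n) = trans (⊖-homo n (suc m)) (+-comm _ _)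
  +‿homo -[1+ m ] -[1+ n ] = begin
    - ⟦ suc (suc (m +ℕ n)) ⟧ℕ            ≡⟨ ≡.cong (λ k → - ⟦ suc k ⟧ℕ) (+-suc m n) ⟨
    - ⟦ suc m +ℕ suc n ⟧ℕ                ≈⟨ -‿cong (×-homo-+ 1# (suc m) (suc n)) ⟩
    - (⟦ suc m ⟧ℕ + ⟦ suc n ⟧ℕ)          ≈⟨ ⁻¹-∙-comm _ _ ⟨
    - ⟦ suc m ⟧ℕ - ⟦ suc n ⟧ℕ            ∎

  +◃-homo : ∀ n → ⟦ Sign.+ ◃ n ⟧ℤ ≈ ⟦ n ⟧ℕ
  +◃-homo n rewrite ℤ.+◃n≡+n n = refl

  -◃-homo : ∀ n → ⟦ Sign.- ◃ n ⟧ℤ ≈ - ⟦ n ⟧ℕ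
  -◃-homo n rewrite ℤ.-◃n≡-n n = -‿homo (+ n)

  *‿homo : ∀ i j → ⟦ i *ℤ j ⟧ℤ ≈ ⟦ i ⟧ℤ * ⟦ j ⟧ℤ
  *‿homo (+ m) (+ n) = trans (+◃-homo (m *ℕ n)) (×1-homo-* m n)
  *‿homo (+ m) -[1+ n ] =
    trans (-◃-homo (m *ℕ suc n)) (trans (-‿cong (×1-homo-* m (suc n))) (-‿distribʳ-* _ _))
  *‿homo -[1+ m ] (+ n) =
    trans (-◃-homo (suc m *ℕ n)) (trans (-‿cong (×1-homo-* (suc m) n)) (-‿distribˡ-* _ _))
  *‿homo -[1+ m ] -[1+ n ] = begin
    ⟦ Sign.+ ◃ (suc m *ℕ suc n) ⟧ℤ       ≈⟨ +◃-homo (suc m *ℕ suc n) ⟩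
    ⟦ suc m *ℕ suc n ⟧ℕ                  ≈⟨ ×1-homo-* (suc m) (suc n) ⟩
    ⟦ suc m ⟧ℕ * ⟦ suc n ⟧ℕ              ≈⟨ ⁻¹-involutive _ ⟨
    - - (⟦ suc m ⟧ℕ * ⟦ suc n ⟧ℕ)        ≈⟨ -‿cong (-‿distribˡ-* _ _) ⟩
    - (- ⟦ suc m ⟧ℕ * ⟦ suc n ⟧ℕ)        ≈⟨ -‿distribʳ-* _ _ ⟩
    - ⟦ suc m ⟧ℕ * - ⟦ suc n ⟧ℕ          ∎

  homomorphism : +-*-rawRing ACR.-Raw-AlmostCommutative⟶ ACR.fromCommutativeRing R
  homomorphism = record
    { ⟦_⟧ = ⟦_⟧ℤ ; +-homo = +‿homo ; *-homo = *‿homo ; -‿homo = -‿homo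
    ; 0-homo = refl ; 1-homo = refl }

  coefficient-equality : ∀ i j → Maybe (⟦ i ⟧ℤ ≈ ⟦ j ⟧ℤ)
  coefficient-equality i j = map (λ { ≡.refl → refl }) (dec⇒weaklyDec ℤ._≟_ i j)

  open import Algebra.Solver.Ring +-*-rawRing (ACR.fromCommutativeRing R) homomorphism coefficient-equality public

F-positive : ∀ m → 1 ≤ F (suc m)
F-positive zero = s≤s z≤n
F-positive (suc m) = ≤-trans (F-positive m) (m≤m+n (F (suc m)) (F m))

-- Identities for the sequences U, T, x of Defs.Lucas.
module LucasIdentities {c ℓ} (D : IntegralDomain c ℓ) (p q : IntegralDomain.Carrier D) where
  open IntegralDomain D hiding (zero)
  open Lucas D p q
  open IntegerCoefficientSolver commutativeRing
    using (solve; _:=_; _:+_; _:*_; _:-_; :-_; con; Polynomial)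
  open import Relation.Binary.Reasoning.Setoid setoid

  U-addition : ∀ m k → U (m +ℕ suc k) ≈ U (suc m) * U (suc k) - q * U m * U k
  U-addition zero k =
    solve 3 (λ q b₁ b₀ → b₁ := con (+ 1) :* b₁ :- q :* con (+ 0) :* b₀) refl q (U (suc k)) (U k)
  U-addition (suc zero) k =
    solve 4 (λ p q b₁ b₀ → p :* b₁ :- q :* b₀ := (p :* con (+ 1) :- q :* con (+ 0)) :* b₁ :- q :* con (+ 1) :* b₀)
      refl p q (U (suc k)) (U k)
  U-addition (suc (suc m)) k =
    trans (+-cong (*-cong refl (U-addition (suc m) k)) (-‿cong (*-cong refl (U-addition m k))))
      (solve 6 (λ p q a₁ a₀ b₁ b₀ →
         p :* ((p :* a₁ :- q :* a₀) :* b₁ :- q :* a₁ :* b₀) :- q :* (a₁ :* b₁ :- q :* a₀ :* b₀)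
         := (p :* (p :* a₁ :- q :* a₀) :- q :* a₁) :* b₁ :- q :* (p :* a₁ :- q :* a₀) :* b₀)
         refl p q (U (suc m)) (U m) (U (suc k)) (U k))

  T-via-U : ∀ b → T (suc b) ≈ - q * U b
  T-via-U zero = solve 1 (λ q → con (+ 0) := :- q :* con (+ 0)) refl q
  T-via-U (suc zero) = solve 2 (λ p q → p :* con (+ 0) :- q :* con (+ 1) := :- q :* con (+ 1)) refl p q
  T-via-U (suc (suc b)) =
    trans (+-cong (*-cong refl (T-via-U (suc b))) (-‿cong (*-cong refl (T-via-U b))))
      (solve 4 (λ p q u₁ u₀ → p :* (:- q :* u₁) :- q :* (:- q :* u₀) := :- q :* (p :* u₁ :- q :* u₀))
         refl p q (U (suc b)) (U b))

  U-sum-via-T : ∀ a b →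
    U (suc a +ℕ suc b) ≈ U (suc a) * T (suc b) + T (suc a) * U (suc b) + p * U (suc a) * U (suc b)
  U-sum-via-T a b = begin
    U (suc a +ℕ suc b)
      ≈⟨ U-addition (suc a) b ⟩
    U (suc (suc a)) * U (suc b) - q * U (suc a) * U b
      ≈⟨ solve 6 (λ p q A A' B B' →
           (p :* A :- q :* A') :* B :- q :* A :* B'
           := A :* (:- q :* B') :+ (:- q :* A') :* B :+ p :* A :* B)
           refl p q (U (suc a)) (U a) (U (suc b)) (U b) ⟩
    U (suc a) * (- q * U b) + (- q * U a) * U (suc b) + p * U (suc a) * U (suc b)
      ≈⟨ +-cong (+-cong (*-cong refl (T-via-U b)) (*-cong (T-via-U a) refl)) refl ⟨
    U (suc a) * T (suc b) + T (suc a) * U (suc b) + p * U (suc a) * U (suc b) ∎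

  U-sum-via-U : ∀ a b →
    U (suc a +ℕ suc b) ≈ - q * (U (suc a) * U b + U a * U (suc b)) + p * U (suc a) * U (suc b)
  U-sum-via-U a b = begin
    U (suc a +ℕ suc b)
      ≈⟨ U-addition (suc a) b ⟩
    U (suc (suc a)) * U (suc b) - q * U (suc a) * U b
      ≈⟨ solve 6 (λ p q A A' B B' →
           (p :* A :- q :* A') :* B :- q :* A :* B'
           := :- q :* (A :* B' :+ A' :* B) :+ p :* A :* B)
           refl p q (U (suc a)) (U a) (U (suc b)) (U b) ⟩
    - q * (U (suc a) * U b + U a * U (suc b)) + p * U (suc a) * U (suc b) ∎

  -- The fraction operations of Defs.Lucas transcribed into solver syntax, so
  -- that an identity between fractions can be handed to the solver verbatim.
  module FractionSyntax {n : ℕ} where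
    infixl 6 _:+F_ _:-F_
    infixl 7 _:*F_ _:/F_

    :ι : Polynomial n → Polynomial n × Polynomial n
    :ι a = (a , con (+ 1))

    _:+F_ _:-F_ _:*F_ _:/F_ : Polynomial n × Polynomial n → Polynomial n × Polynomial n → Polynomial n × Polynomial n
    (a , b) :+F (c , d) = (a :* d :+ c :* b , b :* d)
    (a , b) :-F (c , d) = (a :* d :- c :* b , b :* d)
    (a , b) :*F (c , d) = (a :* c , b :* d)
    (a , b) :/F (c , d) = (a :* d , b :* c)

  ratio-identity : ∀ A A' B B' →
    let ratio = (ι q *F (A , A') +F ι q *F (B , B') -F ι p *F (A , A') *F (B , B'))
                /F (ι q -F (A , A') *F (B , B'))
    in ((p * A - q * A') * B - q * A * B') * den ratio ≈ num ratio * (A * B - q * A' * B')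
  ratio-identity = solve 6 (λ p q A A' B B' →
    let ratio = (:ι q :*F (A , A') :+F :ι q :*F (B , B') :-F :ι p :*F (A , A') :*F (B , B'))
                :/F (:ι q :-F (A , A') :*F (B , B'))
    in ((p :* A :- q :* A') :* B :- q :* A :* B') :* proj₂ ratio := proj₁ ratio :* (A :* B :- q :* A' :* B'))
    refl p q
    where open FractionSyntax

  x-sum : ∀ a b →
    x (suc a +ℕ suc b) ≈F (ι q *F x (suc a) +F ι q *F x (suc b) -F ι p *F x (suc a) *F x (suc b))
                          /F (ι q -F x (suc a) *F x (suc b))
  x-sum a b =
    trans (*-cong (U-addition (suc a) b) refl)
      (trans (ratio-identity (U (suc a)) (U a) (U (suc b)) (U b))
        (*-cong refl (sym (U-addition a b))))

  -- The three addition formulas for indices a , b, phrased with a - 1 and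
  -- b - 1 as in the corollary.  The cross-multiplied form of the third one
  -- holds without its definedness hypotheses.
  AdditionFormulas : ℕ → ℕ → Set ℓ
  AdditionFormulas a b =
      (U (a +ℕ b) ≈ U a * T b + T a * U b + p * U a * U b)
      × (U (a +ℕ b) ≈ - q * (U a * U (b ∸ 1) + U (a ∸ 1) * U b) + p * U a * U b)
      × (Defined (x (a +ℕ b)) → Defined (x a) → Defined (x b) →
         NonZeroF (ι q -F x a *F x b) →
         x (a +ℕ b) ≈F (ι q *F x a +F ι q *F x b -F ι p *F x a *F x b) /F (ι q -F x a *F x b))

  addition-formulas : ∀ a b → 1 ≤ a → 1 ≤ b → AdditionFormulas a b
  addition-formulas (suc a) (suc b) _ _ =
    U-sum-via-T a b , U-sum-via-U a b , λ _ _ _ _ → x-sum a b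

-- Corollary 2.7: the addition formulas at the indices F (n-1), F (n-2),
-- whose sum is F n.  Positivity of both indices only needs n ≥ 3.
corollary2p7 : ∀ {c ℓ} (D : IntegralDomain c ℓ) (p q : IntegralDomain.Carrier D) →
  let open IntegralDomain D
      open Lucas D p q
  in ∀ (n : ℕ) → 5 ≤ n →
    (U (F n) ≈ U (F (n ∸ 1)) * T (F (n ∸ 2)) + T (F (n ∸ 1)) * U (F (n ∸ 2)) + p * U (F (n ∸ 1)) * U (F (n ∸ 2)))
    × (U (F n) ≈ - q * (U (F (n ∸ 1)) * U (F (n ∸ 2) ∸ 1) + U (F (n ∸ 1) ∸ 1) * U (F (n ∸ 2))) + p * U (F (n ∸ 1)) * U (F (n ∸ 2)))
    × (Defined (x (F n)) → Defined (x (F (n ∸ 1))) → Defined (x (F (n ∸ 2))) →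
       NonZeroF (ι q -F x (F (n ∸ 1)) *F x (F (n ∸ 2))) →
       x (F n) ≈F (ι q *F x (F (n ∸ 1)) +F ι q *F x (F (n ∸ 2)) -F ι p *F x (F (n ∸ 1)) *F x (F (n ∸ 2)))
                  /F (ι q -F x (F (n ∸ 1)) *F x (F (n ∸ 2))))
corollary2p7 D p q (suc (suc (suc m))) (s≤s (s≤s (s≤s _))) =
  LucasIdentities.addition-formulas D p q (F (suc (suc m))) (F (suc m)) (F-positive (suc m)) (F-positive m)
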